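{- Let $p$ be a prime, $n\geq 1$ an integer, and $F_2(n)=\prod_{k=1}^n (k!)^{k}$. Then $$\nu_p\left[F_2(n)\right]\leq\frac{n(n^2-1)}{3(p-1)}.$$
   Context: For a prime $p$ and a positive integer $m$, $\nu_p(m)=\max\{k\in\mathbb{N}: p^k\mid m\}$ denotes the $p$-adic valuation of $m$. -}

module Defs where

open import Data.Nat using (ℕ; zero; suc; _*_; _^_; _!)

F₂ : ℕ → ℕ
F₂ zero    = 1
F₂ (suc n) = F₂ n * ((suc n) !) ^ (suc n)

{-# OPTIONS --safe #-}
-- Legendre's bound (p − 1)·ν_p(m!) ≤ m − 1 follows by strong induction on m from
-- ν_p((q p + r)!) = q + ν_p(q!) for r < p, as the multiples of p up to q p + r are
-- p, 2p, …, q p. Since ν_p(F₂ n) = Σ_{m ≤ n} m·ν_p(m!), it follows that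
-- (p − 1)·ν_p(F₂ n) ≤ Σ_{m ≤ n} m(m − 1) = (n + 1)n(n − 1)/3.
module Submission where

open import Defs
open import Data.Nat using (ℕ; zero; suc; pred; _+_; _*_; _∸_; _^_; _≤_; _<_; _!; z≤n; s≤s; NonZero; NonTrivial; nonTrivial⇒≢1; nonTrivial⇒n>1)
open import Data.Nat.Properties
open import Data.Nat.Divisibility using (_∣_; _∤_; divides; 1∣_; ∣1⇒≡1; ∣-trans; m∣m*n; n∣m*n; *-pres-∣; *-monoʳ-∣; *-cancelˡ-∣; ∣⇒≤; ∣m+n∣m⇒∣n)
open import Data.Nat.DivMod using (_/_; m≡m%n+[m/n]*n; m%n<n; m/n<m; m/n*n≤m)
open import Data.Nat.Primality using (Prime; euclidsLemma; prime⇒nonZero; prime⇒nonTrivial)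
open import Data.Nat.Induction using (<-rec)
open import Data.Nat.Tactic.RingSolver using (solve-∀)
open import Data.Product using (∃₂; _×_; _,_)
open import Data.Sum using ([_,_]′)
open import Data.Empty using (⊥-elim)
open import Function using (id; _∘_)
open import Relation.Binary.PropositionalEquality using (_≡_; refl; sym; trans; cong; subst)

m^n∣1⇒n≡0 : ∀ m n .{{_ : NonTrivial m}} → m ^ n ∣ 1 → n ≡ 0
m^n∣1⇒n≡0 m n m^n∣1 = [ id , ⊥-elim ∘ nonTrivial⇒≢1 ]′ (m^n≡1⇒n≡0∨m≡1 m n (∣1⇒≡1 m^n∣1))

^-monoʳ-∣ : ∀ m {n o} → n ≤ o → m ^ n ∣ m ^ o
^-monoʳ-∣ m z≤n       = 1∣ _
^-monoʳ-∣ m (s≤s n≤o) = *-monoʳ-∣ m (^-monoʳ-∣ m n≤o)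

m+n∸o≤m+[n∸o] : ∀ m n o → m + n ∸ o ≤ m + (n ∸ o)
m+n∸o≤m+[n∸o] m n       zero    = ≤-refl
m+n∸o≤m+[n∸o] m zero    (suc o) = m∸n≤m (m + 0) (suc o)
m+n∸o≤m+[n∸o] m (suc n) (suc o) rewrite +-suc m n = m+n∸o≤m+[n∸o] m n o

[m∸1]*n+[n∸1]≡n*m∸1 : ∀ m n .{{_ : NonZero m}} → (m ∸ 1) * n + (n ∸ 1) ≡ n * m ∸ 1
[m∸1]*n+[n∸1]≡n*m∸1 (suc m) zero    = trans (+-identityʳ (m * 0)) (*-zeroʳ m)
[m∸1]*n+[n∸1]≡n*m∸1 (suc m) (suc n) = identity m n
  where
  identity : ∀ m n → m * suc n + n ≡ m + n * suc m
  identity = solve-∀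

[1+m]*n!≡n*[[1+m]*[pred[n]+m*n]!] : ∀ m n .{{_ : NonZero n}} →
                                    (suc m * n) ! ≡ n * (suc m * (pred n + m * n) !)
[1+m]*n!≡n*[[1+m]*[pred[n]+m*n]!] m (suc n) =
  trans (cong (_* (n + m * suc n) !) (*-comm (suc m) (suc n))) (*-assoc (suc n) (suc m) _)

n∤r+q*n : ∀ {n r} q .{{_ : NonZero r}} → r < n → n ∤ r + q * n
n∤r+q*n {n} {r} q r<n n∣r+q*n =
  <⇒≱ r<n (∣⇒≤ (∣m+n∣m⇒∣n (subst (n ∣_) (+-comm r (q * n)) n∣r+q*n) (n∣m*n q)))

-- c ·ν[ p ] x ≤ b  expresses  c · ν_p(x) ≤ b.
infix 4 _·ν[_]_≤_
record _·ν[_]_≤_ (c p x b : ℕ) : Set where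
  field
    bound : ∀ k → p ^ k ∣ x → c * k ≤ b
open _·ν[_]_≤_

·ν-1 : ∀ {c p} .{{_ : NonTrivial p}} → c ·ν[ p ] 1 ≤ 0
·ν-1 {c} {p} .bound k p^k∣1 = ≤-reflexive (trans (cong (c *_) (m^n∣1⇒n≡0 p k p^k∣1)) (*-zeroʳ c))

·ν-scale : ∀ d {c p x b} → c ·ν[ p ] x ≤ b → d * c ·ν[ p ] x ≤ d * b
·ν-scale d {c} {b = b} ν .bound k p^k∣x =
  subst (_≤ d * b) (sym (*-assoc d c k)) (*-monoʳ-≤ d (ν .bound k p^k∣x))

module _ {p : ℕ} (p-prime : Prime p) where

  private instance
    p-nonTrivial : NonTrivial p
    p-nonTrivial = prime⇒nonTrivial p-prime
    p-nonZero : NonZero p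
    p-nonZero = prime⇒nonZero p-prime

  p^k∣m*n⇒split : ∀ k m n → p ^ k ∣ m * n →
                  ∃₂ λ i j → i + j ≡ k × p ^ i ∣ m × p ^ j ∣ n
  p^k∣m*n⇒split zero    m n _ = 0 , 0 , refl , 1∣ m , 1∣ n
  p^k∣m*n⇒split (suc k) m n p^[1+k]∣m*n =
    [ (λ p∣m → peel p∣m p^[1+k]∣m*n) , (λ p∣n → swap (peel p∣n p^[1+k]∣n*m)) ]′
      (euclidsLemma m n p-prime (∣-trans (m∣m*n (p ^ k)) p^[1+k]∣m*n))
    where
    p^[1+k]∣n*m : p ^ suc k ∣ n * m
    p^[1+k]∣n*m = subst (p ^ suc k ∣_) (*-comm m n) p^[1+k]∣m*n

    peel : ∀ {a b} → p ∣ a → p ^ suc k ∣ a * b →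
           ∃₂ λ i j → i + j ≡ suc k × p ^ i ∣ a × p ^ j ∣ b
    peel {b = b} (divides a′ refl) p^[1+k]∣a′*p*b
      with p^k∣m*n⇒split k a′ b (*-cancelˡ-∣ p (subst (p ^ suc k ∣_) a′*p*b≡p*[a′*b] p^[1+k]∣a′*p*b))
      where
      a′*p*b≡p*[a′*b] : a′ * p * b ≡ p * (a′ * b)
      a′*p*b≡p*[a′*b] = trans (cong (_* b) (*-comm a′ p)) (*-assoc p a′ b)
    ... | i , j , refl , p^i∣a′ , p^j∣b =
      suc i , j , refl , subst (p ^ suc i ∣_) (*-comm p a′) (*-monoʳ-∣ p p^i∣a′) , p^j∣b

    swap : (∃₂ λ j i → j + i ≡ suc k × p ^ j ∣ n × p ^ i ∣ m) →
           (∃₂ λ i j → i + j ≡ suc k × p ^ i ∣ m × p ^ j ∣ n)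
    swap (j , i , j+i≡1+k , p^j∣n , p^i∣m) = i , j , trans (+-comm i j) j+i≡1+k , p^i∣m , p^j∣n

  p∤m⇒p^k∣m*n⇒p^k∣n : ∀ {k m n} → p ∤ m → p ^ k ∣ m * n → p ^ k ∣ n
  p∤m⇒p^k∣m*n⇒p^k∣n {k} {m} {n} p∤m p^k∣m*n with p^k∣m*n⇒split k m n p^k∣m*n
  ... | zero  , _ , refl , _    , p^k∣n = p^k∣n
  ... | suc i , _ , _    , p^i∣m , _    = ⊥-elim (p∤m (∣-trans (m∣m*n (p ^ i)) p^i∣m))

  p^k∣[r+q*p]!⇒p^k∣[q*p]! : ∀ {k r} q → r < p → p ^ k ∣ (r + q * p) ! → p ^ k ∣ (q * p) !
  p^k∣[r+q*p]!⇒p^k∣[q*p]! {r = zero}  q _   p^k∣[r+q*p]! = p^k∣[r+q*p]!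
  p^k∣[r+q*p]!⇒p^k∣[q*p]! {k} {suc r} q r<p p^k∣[r+q*p]! =
    p^k∣[r+q*p]!⇒p^k∣[q*p]! {k} q (<⇒≤ r<p) (p∤m⇒p^k∣m*n⇒p^k∣n {k} (n∤r+q*n q r<p) p^k∣[r+q*p]!)

  p^k∣[q*p]!⇒p^[k∸q]∣q! : ∀ q {k} → p ^ k ∣ (q * p) ! → p ^ (k ∸ q) ∣ q !
  p^k∣[q*p]!⇒p^[k∸q]∣q! zero    p^k∣1 = p^k∣1
  p^k∣[q*p]!⇒p^[k∸q]∣q! (suc q) {zero}  _ = 1∣ _
  p^k∣[q*p]!⇒p^[k∸q]∣q! (suc q) {suc k} p^[1+k]∣[[1+q]*p]!
    with p^k∣m*n⇒split k (suc q) ((pred p + q * p) !) p^k∣[1+q]*[pred[p]+q*p]!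
    where
    p^k∣[1+q]*[pred[p]+q*p]! : p ^ k ∣ suc q * (pred p + q * p) !
    p^k∣[1+q]*[pred[p]+q*p]! = *-cancelˡ-∣ p
      (subst (p ^ suc k ∣_) ([1+m]*n!≡n*[[1+m]*[pred[n]+m*n]!] q p) p^[1+k]∣[[1+q]*p]!)
  ... | i , j , refl , p^i∣1+q , p^j∣[pred[p]+q*p]! =
    ∣-trans (^-monoʳ-∣ p (m+n∸o≤m+[n∸o] i j q))
            (subst (_∣ suc q !) (sym (^-distribˡ-+-* p i (j ∸ q))) (*-pres-∣ p^i∣1+q p^[j∸q]∣q!))
    where
    p^[j∸q]∣q! : p ^ (j ∸ q) ∣ q !
    p^[j∸q]∣q! = p^k∣[q*p]!⇒p^[k∸q]∣q! q
      (p^k∣[r+q*p]!⇒p^k∣[q*p]! {j} q (≤-reflexive (suc-pred p)) p^j∣[pred[p]+q*p]!)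

  ·ν-* : ∀ {c m n a b} → c ·ν[ p ] m ≤ a → c ·ν[ p ] n ≤ b → c ·ν[ p ] m * n ≤ a + b
  ·ν-* {c} {m} {n} {a} {b} νm νn .bound k p^k∣m*n with p^k∣m*n⇒split k m n p^k∣m*n
  ... | i , j , refl , p^i∣m , p^j∣n =
    subst (_≤ a + b) (sym (*-distribˡ-+ c i j)) (+-mono-≤ (νm .bound i p^i∣m) (νn .bound j p^j∣n))

  ·ν-^ : ∀ e {c m a} → c ·ν[ p ] m ≤ a → c ·ν[ p ] m ^ e ≤ e * a
  ·ν-^ zero    _  = ·ν-1
  ·ν-^ (suc e) νm = ·ν-* νm (·ν-^ e νm)

  ·ν-! : ∀ m → p ∸ 1 ·ν[ p ] m ! ≤ m ∸ 1
  ·ν-! = <-rec _ legendre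
    where
    legendre : ∀ m → (∀ {q} → q < m → p ∸ 1 ·ν[ p ] q ! ≤ q ∸ 1) → p ∸ 1 ·ν[ p ] m ! ≤ m ∸ 1
    legendre zero      _  = ·ν-1
    legendre m@(suc _) ih .bound k p^k∣m! = begin
      (p ∸ 1) * k                      ≤⟨ *-monoʳ-≤ (p ∸ 1) (m≤n+m∸n k q) ⟩
      (p ∸ 1) * (q + (k ∸ q))          ≡⟨ *-distribˡ-+ (p ∸ 1) q (k ∸ q) ⟩
      (p ∸ 1) * q + (p ∸ 1) * (k ∸ q)  ≤⟨ +-monoʳ-≤ ((p ∸ 1) * q) (ih q<m .bound (k ∸ q) p^[k∸q]∣q!) ⟩
      (p ∸ 1) * q + (q ∸ 1)            ≡⟨ [m∸1]*n+[n∸1]≡n*m∸1 p q ⟩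
      q * p ∸ 1                        ≤⟨ ∸-monoˡ-≤ 1 (m/n*n≤m m p) ⟩
      m ∸ 1                            ∎
      where
      open ≤-Reasoning
      q : ℕ
      q = m / p
      q<m : q < m
      q<m = m/n<m m p (nonTrivial⇒n>1 p)
      p^[k∸q]∣q! : p ^ (k ∸ q) ∣ q !
      p^[k∸q]∣q! = p^k∣[q*p]!⇒p^[k∸q]∣q! q (p^k∣[r+q*p]!⇒p^k∣[q*p]! {k} q (m%n<n m p)
        (subst (λ x → p ^ k ∣ x !) (m≡m%n+[m/n]*n m p) p^k∣m!))

  ·ν-F₂ : ∀ n → 3 * (p ∸ 1) ·ν[ p ] F₂ n ≤ n * (n * n ∸ 1)
  ·ν-F₂ zero    = ·ν-1
  ·ν-F₂ (suc n) = subst (3 * (p ∸ 1) ·ν[ p ] F₂ (suc n) ≤_) (cubic-step n)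
    (·ν-* (·ν-F₂ n) (·ν-scale 3 (·ν-^ (suc n) (·ν-! (suc n)))))
    where
    cubic-step : ∀ n → n * (n * n ∸ 1) + 3 * (suc n * n) ≡ suc n * (suc n * suc n ∸ 1)
    cubic-step zero    = refl
    cubic-step (suc n) = identity n
      where
      identity : ∀ n → suc n * (n + n * suc n) + 3 * (suc (suc n) * suc n)
                     ≡ suc (suc n) * (suc n + suc n * suc (suc n))
      identity = solve-∀

mainTheorem6 : (p n : ℕ) → Prime p → 1 ≤ n →
    (k : ℕ) → p ^ k ∣ F₂ n → 3 * (p ∸ 1) * k ≤ n * (n * n ∸ 1)
-- The bound holds for n = 0 as well.
mainTheorem6 p n p-prime _ = ·ν-F₂ p-prime n .bound
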